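{- For every integer $n\geq 6$, the complement $C_n^c$ of the cycle $C_n$ is an extremal $\left(n-3\,\middle|\,\left\lceil n/2\right\rceil\right)$-graph; that is, $C_n^c$ is $(n-3)$-regular with chromatic number $\lceil n/2\rceil$, and every $(n-3)$-regular graph with chromatic number $\lceil n/2\rceil$ has at least $n$ vertices.
   Context: An $(r|\chi)$-graph is a simple finite $r$-regular graph with chromatic number $\chi$; it is extremal if it has the minimum possible order among all $(r|\chi)$-graphs. -}

module Defs where

open import Data.Nat using (ℕ; zero; suc; _≤_; _≡ᵇ_)
open import Data.Bool using (Bool; true; false; _∧_; _∨_; not)
open import Data.Fin using (Fin; toℕ)
open import Data.List using (List; length; filter)
open import Data.List.Base using (allFin)
open import Data.Product using (_×_)
open import Relation.Binary.PropositionalEquality using (_≡_; _≢_)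
open import Relation.Nullary.Decidable using (Dec)
open import Data.Bool using (T)
open import Data.Bool.Properties using (T?)

record Graph (n : ℕ) : Set where
  field
    adj    : Fin n → Fin n → Bool
    sym    : ∀ u v → adj u v ≡ adj v u
    irrefl : ∀ v → adj v v ≡ false
open Graph public

degree : ∀ {n} → Graph n → Fin n → ℕ
degree {n} G v = length (filter (λ w → T? (adj G v w)) (allFin n))

Regular : ∀ {n} → ℕ → Graph n → Set
Regular r G = ∀ v → degree G v ≡ r

ProperColouring : ∀ {n} → Graph n → (k : ℕ) → (Fin n → Fin k) → Set
ProperColouring G k c = ∀ u v → adj G u v ≡ true → c u ≢ c v

Colourable : ∀ {n} → Graph n → ℕ → Set
Colourable {n} G k = Data.Product.Σ (Fin n → Fin k) (ProperColouring G k)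

ChromaticNumber : ∀ {n} → Graph n → ℕ → Set
ChromaticNumber G χ = Colourable G χ × (∀ k → Colourable G k → χ ≤ k)

IsRχGraph : ∀ {n} → ℕ → ℕ → Graph n → Set
IsRχGraph r χ G = Regular r G × ChromaticNumber G χ

Extremal : ∀ {n} → ℕ → ℕ → Graph n → Set
Extremal {n} r χ G =
  IsRχGraph r χ G × (∀ m (H : Graph m) → IsRχGraph r χ H → n ≤ m)

cycSucc : (n : ℕ) → Fin n → Fin n → Bool
cycSucc n i j = (suc (toℕ i) ≡ᵇ toℕ j) ∨ ((suc (toℕ i) ≡ᵇ n) ∧ (toℕ j ≡ᵇ 0))

-- adjacency of the cycle C_n (meaningful for n ≥ 3)
cycAdj : (n : ℕ) → Fin n → Fin n → Bool
cycAdj n i j = cycSucc n i j ∨ cycSucc n j i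

cycComplAdj : (n : ℕ) → Fin n → Fin n → Bool
cycComplAdj n i j = not (toℕ i ≡ᵇ toℕ j) ∧ not (cycAdj n i j)

open import Relation.Binary.PropositionalEquality using (refl; cong₂; cong)
open import Data.Bool.Properties using (∨-comm)

private
  ≡ᵇ-sym : ∀ a b → (a ≡ᵇ b) ≡ (b ≡ᵇ a)
  ≡ᵇ-sym zero zero = refl
  ≡ᵇ-sym zero (suc b) = refl
  ≡ᵇ-sym (suc a) zero = refl
  ≡ᵇ-sym (suc a) (suc b) = ≡ᵇ-sym a b

  ≡ᵇ-self : ∀ a → (a ≡ᵇ a) ≡ true
  ≡ᵇ-self zero = refl
  ≡ᵇ-self (suc a) = ≡ᵇ-self a

cycleComplement : (n : ℕ) → Graph n
cycleComplement n = record
  { adj    = cycComplAdj n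
  ; sym    = λ i j → cong₂ _∧_ (cong not (≡ᵇ-sym (toℕ i) (toℕ j)))
                               (cong not (∨-comm (cycSucc n i j) (cycSucc n j i)))
  ; irrefl = λ i → cong (λ b → not b ∧ not (cycAdj n i i)) (≡ᵇ-self (toℕ i))
  }

module Submission where

-- Regularity: a vertex a of C_n^c is adjacent to everything except a and its two cycle
-- neighbours, which are three distinct vertices when n ≥ 3; so its degree is n − 3.
-- Chromatic number: colouring i ↦ ⌊i/2⌋ uses ⌈n/2⌉ colours, since same-coloured vertices
-- are equal or consecutive.  Conversely a colour class of C_n^c is a clique of C_n, and
-- C_n (n ≥ 4) has no triangle, so every colour is used at most twice and n ≤ 2k.
-- Minimality: in an (n−3)-regular graph H on m < n vertices every vertex has
-- m − (n−3) ∈ {1, 2} non-neighbours counting itself.  With one, H is complete and needs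
-- m = n − 2 > ⌈n/2⌉ colours; with two, H is complete minus a perfect matching and can be
-- coloured with m/2 = (n−1)/2 < ⌈n/2⌉ colours, one per matched pair.

open import Defs hiding (sym)
open import Data.Nat using (ℕ; zero; suc; pred; _+_; _*_; _∸_; _≤_; _<_; _≡ᵇ_; _<ᵇ_; z≤n; s≤s; s≤s⁻¹; ⌊_/2⌋; ⌈_/2⌉)
open import Data.Nat.Properties
  using ( +-0-commutativeMonoid; +-identityʳ; +-mono-≤; +-monoˡ-≤; +-cancelʳ-≡; m≤m+n; m+n∸n≡m; suc-injective
        ; ≤-refl; ≤-trans; ≤-reflexive; ≤-antisym; <-trans; <-asym; <-irrefl; <⇒≱; ≤∧≢⇒<; n≤1+n; ≮⇒≥; <⇒≢; 1+n≰n
        ; ≡ᵇ⇒≡; <ᵇ⇒<; <⇒<ᵇ; ⌈n/2⌉-mono; ⌈n/2⌉≤n; ⌊n/2⌋≤⌈n/2⌉; ⌊n/2⌋+⌈n/2⌉≡n; n≡⌈n+n/2⌉; module ≤-Reasoning )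
open import Data.Bool using (Bool; true; false; _∧_; _∨_; not; T; T?; if_then_else_)
open import Data.Bool.Properties
  using (∨-identityʳ; ∨-zeroʳ; ∨-inverseˡ; ∧-identityʳ; ∧-zeroʳ; ∧-inverseˡ; ∧-distribˡ-∨; not-injective; ∨-∧-booleanAlgebra)
  renaming (_≟_ to _≟ᵇ_)
open import Algebra.Lattice.Properties.BooleanAlgebra ∨-∧-booleanAlgebra using (deMorgan₂)
open import Algebra.Properties.CommutativeMonoid.Sum +-0-commutativeMonoid
  using (sum; sum-cong-≗; ∑-distrib-+; sum-permute; sum-replicate-zero)
open import Data.Fin using (Fin; zero; suc; toℕ; fromℕ<; cast; combine; _↑ʳ_) renaming (_<_ to _<ᶠ_)
open import Data.Fin.Properties
  using (toℕ-injective; toℕ<n; toℕ-fromℕ<; toℕ-cast; toℕ-↑ʳ; ↑ʳ-injective; combine-injective; pigeonhole; any?; _≟_; _<?_)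
  renaming (<⇒≢ to <⇒≢ᶠ)
open import Data.Fin.Permutation using (permutation)
open import Data.List using (length; filter; tabulate)
open import Data.Product using (∃; _×_; _,_; proj₁; proj₂)
open import Data.Sum using (_⊎_; inj₁; inj₂)
import Data.Sum as Sum
open import Data.Empty using (⊥; ⊥-elim)
open import Function using (_∘_; id)
open import Relation.Nullary using (¬_; yes; no; contradiction; ¬?; _×-dec_)
open import Relation.Binary.PropositionalEquality
  using (_≡_; _≢_; refl; sym; trans; cong; cong₂; subst; module ≡-Reasoning)

true≢false : true ≢ false
true≢false ()

≡ᵇ-sound : ∀ a b → (a ≡ᵇ b) ≡ true → a ≡ b
≡ᵇ-sound a b e = ≡ᵇ⇒≡ a b (subst T (sym e) _)

≡ᵇ-refl : ∀ a → (a ≡ᵇ a) ≡ true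
≡ᵇ-refl zero    = refl
≡ᵇ-refl (suc a) = ≡ᵇ-refl a

≢⇒≡ᵇ-false : ∀ a b → a ≢ b → (a ≡ᵇ b) ≡ false
≢⇒≡ᵇ-false a b a≢b with a ≡ᵇ b in e
... | true  = contradiction (≡ᵇ-sound a b e) a≢b
... | false = refl

≡ᵇ-comm : ∀ a b → (a ≡ᵇ b) ≡ (b ≡ᵇ a)
≡ᵇ-comm zero    zero    = refl
≡ᵇ-comm zero    (suc b) = refl
≡ᵇ-comm (suc a) zero    = refl
≡ᵇ-comm (suc a) (suc b) = ≡ᵇ-comm a b

≡ᵇ-false⇒≢ : ∀ a b → (a ≡ᵇ b) ≡ false → a ≢ b
≡ᵇ-false⇒≢ a .a e refl = true≢false (trans (sym (≡ᵇ-refl a)) e)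

<ᵇ-sound : ∀ a b → (a <ᵇ b) ≡ true → a < b
<ᵇ-sound a b e = <ᵇ⇒< a b (subst T (sym e) _)

<ᵇ-complete : ∀ a b → (a <ᵇ b) ≡ false → ¬ a < b
<ᵇ-complete a b e a<b = subst T e (<⇒<ᵇ a<b)

<ᵇ-flip : ∀ a b → a ≢ b → (b <ᵇ a) ≡ not (a <ᵇ b)
<ᵇ-flip a b a≢b with a <ᵇ b in ab | b <ᵇ a in ba
... | true  | true  = contradiction (<ᵇ-sound b a ba) (<-asym (<ᵇ-sound a b ab))
... | true  | false = refl
... | false | true  = refl
... | false | false = contradiction (≤-antisym (≮⇒≥ (<ᵇ-complete b a ba)) (≮⇒≥ (<ᵇ-complete a b ab))) a≢b

∨-true : ∀ x y → x ∨ y ≡ true → x ≡ true ⊎ y ≡ true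
∨-true true  y _ = inj₁ refl
∨-true false y e = inj₂ e

∧-true : ∀ x y → x ∧ y ≡ true → x ≡ true × y ≡ true
∧-true true true _ = refl , refl

indicator : Bool → ℕ
indicator true  = 1
indicator false = 0

count : ∀ {n} → (Fin n → Bool) → ℕ
count q = sum (indicator ∘ q)

count-ext : ∀ {n} {p q : Fin n → Bool} → (∀ w → p w ≡ q w) → count p ≡ count q
count-ext p≗q = sum-cong-≗ (cong indicator ∘ p≗q)

count-true : ∀ {n} → count {n} (λ _ → true) ≡ n
count-true {zero}  = refl
count-true {suc n} = cong suc (count-true {n})

count-∨ : ∀ {n} (p q : Fin n → Bool) → (∀ w → p w ∧ q w ≡ false) →
          count (λ w → p w ∨ q w) ≡ count p + count q
count-∨ p q disjoint =
  trans (sum-cong-≗ (λ w → indicator-∨ (p w) (q w) (disjoint w))) (∑-distrib-+ (indicator ∘ p) (indicator ∘ q))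
  where
  indicator-∨ : ∀ x y → x ∧ y ≡ false → indicator (x ∨ y) ≡ indicator x + indicator y
  indicator-∨ true  true  ()
  indicator-∨ true  false _ = refl
  indicator-∨ false y     _ = refl

count-complement : ∀ {n} (q : Fin n → Bool) → count (not ∘ q) + count q ≡ n
count-complement {n} q = begin
  count (not ∘ q) + count q      ≡⟨ count-∨ (not ∘ q) q (∧-inverseˡ ∘ q) ⟨
  count (λ w → not (q w) ∨ q w)  ≡⟨ count-ext (∨-inverseˡ ∘ q) ⟩
  count {n} (λ _ → true)         ≡⟨ count-true ⟩
  n                              ∎
  where open ≡-Reasoning

count-mono : ∀ {n} (p q : Fin n → Bool) → (∀ w → p w ≡ true → q w ≡ true) → count p ≤ count q
count-mono {zero}  p q p⇒q = z≤n
count-mono {suc n} p q p⇒q = +-mono-≤ (indicator-mono (p zero) (q zero) (p⇒q zero)) (count-mono (p ∘ suc) (q ∘ suc) (p⇒q ∘ suc))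
  where
  indicator-mono : ∀ x y → (x ≡ true → y ≡ true) → indicator x ≤ indicator y
  indicator-mono true  y x⇒y rewrite x⇒y refl = s≤s z≤n
  indicator-mono false y _   = z≤n

count-involution : ∀ {n} (q : Fin n → Bool) (σ : Fin n → Fin n) → (∀ v → σ (σ v) ≡ v) →
                   count q ≡ count (q ∘ σ)
count-involution q σ σσ = sum-permute (indicator ∘ q) (permutation σ σ σσ σσ)

enumerate : ∀ {n} (q : Fin n → Bool) (x : Fin n) → q x ≡ true → Fin (count q)
enumerate {suc n} q zero    e = cast (cong (λ b → indicator b + count (q ∘ suc)) (sym e)) zero
enumerate {suc n} q (suc x) e = indicator (q zero) ↑ʳ enumerate (q ∘ suc) x e

enumerate-first≢later : ∀ {n} (q : Fin (suc n) → Bool) (y : Fin n) (ex : q zero ≡ true) (ey : q (suc y) ≡ true) →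
                        enumerate q zero ex ≢ enumerate q (suc y) ey
enumerate-first≢later q y ex ey eq = 0≢suc (begin
  0                                            ≡⟨ toℕ-cast _ zero ⟨
  toℕ (enumerate q zero ex)                    ≡⟨ cong toℕ eq ⟩
  toℕ (enumerate q (suc y) ey)                 ≡⟨ toℕ-↑ʳ (indicator (q zero)) _ ⟩
  indicator (q zero) + toℕ (enumerate (q ∘ suc) y ey)  ≡⟨ cong (λ b → indicator b + toℕ (enumerate (q ∘ suc) y ey)) ex ⟩
  suc (toℕ (enumerate (q ∘ suc) y ey))         ∎)
  where
  open ≡-Reasoning
  0≢suc : ∀ {k} → 0 ≢ suc k
  0≢suc ()

enumerate-injective : ∀ {n} (q : Fin n → Bool) (x y : Fin n) (ex : q x ≡ true) (ey : q y ≡ true) →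
                      enumerate q x ex ≡ enumerate q y ey → x ≡ y
enumerate-injective q zero    zero    _  _  _  = refl
enumerate-injective q zero    (suc y) ex ey eq = ⊥-elim (enumerate-first≢later q y ex ey eq)
enumerate-injective q (suc x) zero    ex ey eq = ⊥-elim (enumerate-first≢later q x ey ex (sym eq))
enumerate-injective q (suc x) (suc y) ex ey eq =
  cong suc (enumerate-injective (q ∘ suc) x y ex ey (↑ʳ-injective (indicator (q zero)) _ _ eq))

at : ∀ {n} → ℕ → Fin n → Bool
at a w = toℕ w ≡ᵇ a

count-at : ∀ {n a} → a < n → count {n} (at a) ≡ 1
count-at {suc n} {zero}  _           = cong suc (sum-replicate-zero n)
count-at {suc n} {suc a} (s≤s a<n) = count-at {n} a<n

at-disjoint : ∀ {n a b} → a ≢ b → (w : Fin n) → at a w ∧ at b w ≡ false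
at-disjoint {a = a} {b} a≢b w with toℕ w ≡ᵇ a in e
... | true  = ≢⇒≡ᵇ-false (toℕ w) b (λ w≡b → a≢b (trans (sym (≡ᵇ-sound (toℕ w) a e)) w≡b))
... | false = refl

at-toℕ : ∀ {n} (q : Fin n → Bool) {x w : Fin n} → q x ≡ true → at (toℕ x) w ≡ true → q w ≡ true
at-toℕ q qx e = subst (λ v → q v ≡ true) (sym (toℕ-injective (≡ᵇ-sound _ _ e))) qx

count≥1 : ∀ {n} (q : Fin n → Bool) (x : Fin n) → q x ≡ true → 1 ≤ count q
count≥1 {n} q x qx = ≤-trans (≤-reflexive (sym (count-at (toℕ<n x)))) (count-mono (at (toℕ x)) q (λ w → at-toℕ q qx))

count-at₂ : ∀ {n a b} → a < n → b < n → a ≢ b → count {n} (λ w → at a w ∨ at b w) ≡ 2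
count-at₂ {n} {a} {b} a<n b<n a≢b = trans (count-∨ {n} (at a) (at b) (at-disjoint a≢b)) (cong₂ _+_ (count-at a<n) (count-at b<n))

count-at₃ : ∀ {n a b c} → a < n → b < n → c < n → a ≢ b → a ≢ c → b ≢ c →
            count {n} (λ w → at a w ∨ (at b w ∨ at c w)) ≡ 3
count-at₃ {n} {a} {b} {c} a<n b<n c<n a≢b a≢c b≢c =
  trans (count-∨ {n} (at a) (λ w → at b w ∨ at c w) (λ w → trans (∧-distribˡ-∨ (at a w) (at b w) (at c w)) (cong₂ _∨_ (at-disjoint a≢b w) (at-disjoint a≢c w))))
        (cong₂ _+_ (count-at a<n) (count-at₂ b<n c<n b≢c))

count≤1 : ∀ {n} (q : Fin n → Bool) (x : Fin n) → (∀ w → q w ≡ true → w ≡ x) → count q ≤ 1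
count≤1 q x only-x = ≤-trans (count-mono q (at (toℕ x)) at-x) (≤-reflexive (count-at (toℕ<n x)))
  where
  at-x : ∀ w → q w ≡ true → at (toℕ x) w ≡ true
  at-x w e rewrite only-x w e = ≡ᵇ-refl (toℕ x)

count≥2 : ∀ {n} (q : Fin n → Bool) (x y : Fin n) → x ≢ y → q x ≡ true → q y ≡ true → 2 ≤ count q
count≥2 q x y x≢y qx qy =
  ≤-trans (≤-reflexive (sym (count-at₂ (toℕ<n x) (toℕ<n y) (x≢y ∘ toℕ-injective)))) (count-mono _ q in-q)
  where
  in-q : ∀ w → at (toℕ x) w ∨ at (toℕ y) w ≡ true → q w ≡ true
  in-q w e with ∨-true (at (toℕ x) w) _ e
  ... | inj₁ wx = at-toℕ q qx wx
  ... | inj₂ wy = at-toℕ q qy wy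

count≥3 : ∀ {n} (q : Fin n → Bool) (x y z : Fin n) → x ≢ y → x ≢ z → y ≢ z →
          q x ≡ true → q y ≡ true → q z ≡ true → 3 ≤ count q
count≥3 q x y z x≢y x≢z y≢z qx qy qz =
  ≤-trans (≤-reflexive (sym (count-at₃ (toℕ<n x) (toℕ<n y) (toℕ<n z)
                                        (x≢y ∘ toℕ-injective) (x≢z ∘ toℕ-injective) (y≢z ∘ toℕ-injective))))
          (count-mono _ q in-q)
  where
  in-q : ∀ w → at (toℕ x) w ∨ (at (toℕ y) w ∨ at (toℕ z) w) ≡ true → q w ≡ true
  in-q w e with ∨-true (at (toℕ x) w) _ e
  ... | inj₁ wx = at-toℕ q qx wx
  ... | inj₂ e′ with ∨-true (at (toℕ y) w) _ e′
  ...   | inj₁ wy = at-toℕ q qy wy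
  ...   | inj₂ wz = at-toℕ q qz wz

degree≡count : ∀ {n} (G : Graph n) (v : Fin n) → degree G v ≡ count (adj G v)
degree≡count G v = length-filter-tabulate id (adj G v)
  where
  length-filter-tabulate : ∀ {m n} (f : Fin m → Fin n) (q : Fin n → Bool) →
                           length (filter (λ w → T? (q w)) (tabulate f)) ≡ count (q ∘ f)
  length-filter-tabulate {zero}  f q = refl
  length-filter-tabulate {suc m} f q with q (f zero)
  ... | true  = cong suc (length-filter-tabulate (f ∘ suc) q)
  ... | false = length-filter-tabulate (f ∘ suc) q

-- The number of vertices not adjacent to v, v itself included.
coDegree : ∀ {n} → Graph n → Fin n → ℕ
coDegree G v = count (not ∘ adj G v)

coDegree+degree : ∀ {n} (G : Graph n) (v : Fin n) → coDegree G v + degree G v ≡ n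
coDegree+degree G v = trans (cong (coDegree G v +_) (degree≡count G v)) (count-complement (adj G v))

-- Irreflexivity: v is a non-neighbour of itself.
coDegree≥1 : ∀ {n} (G : Graph n) (v : Fin n) → 1 ≤ coDegree G v
coDegree≥1 G v = count≥1 (not ∘ adj G v) v (cong not (irrefl G v))

same-colour⇒non-adjacent : ∀ {n k} (G : Graph n) {c : Fin n → Fin k} → ProperColouring G k c →
                           ∀ u v → c u ≡ c v → adj G u v ≡ false
same-colour⇒non-adjacent G proper u v cu≡cv with adj G u v in e
... | true  = contradiction cu≡cv (proper u v e)
... | false = refl

identity-colouring : ∀ {n} (G : Graph n) → Colourable G n
identity-colouring G = id , λ u v adjacent u≡v → true≢false (trans (sym adjacent) (subst (λ w → adj G u w ≡ false) u≡v (irrefl G u)))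

complete⇒colours≥order : ∀ {n k} (G : Graph n) → (∀ u v → u ≢ v → adj G u v ≡ true) → Colourable G k → n ≤ k
complete⇒colours≥order G complete (c , proper) = ≮⇒≥ λ k<n →
  let (i , j , i<j , ci≡cj) = pigeonhole k<n c in proper i j (complete i j (<⇒≢ᶠ i<j)) ci≡cj

coDegree≡1⇒complete : ∀ {n} (G : Graph n) → (∀ v → coDegree G v ≡ 1) → ∀ u v → u ≢ v → adj G u v ≡ true
coDegree≡1⇒complete G coDegree≡1 u v u≢v with adj G u v in e
... | true  = refl
... | false = contradiction (subst (2 ≤_) (coDegree≡1 u) two) 1+n≰n
  where
  two : 2 ≤ coDegree G u
  two = count≥2 (not ∘ adj G u) u v u≢v (cong not (irrefl G u)) (cong not e)

-- If no colour is used on three vertices, then n vertices need at least n/2 colours: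
-- tagging each vertex by whether an earlier vertex has its colour is then injective.
at-most-two-per-colour : ∀ {n k} (c : Fin n → Fin k) →
                         (∀ h i j → h <ᶠ i → i <ᶠ j → c h ≡ c i → c i ≡ c j → ⊥) → n ≤ k + k
at-most-two-per-colour {n} {k} c no-triple = ≮⇒≥ λ 2k<n →
  let (i , j , i<j , eq) = pigeonhole (subst (_< n) (cong (k +_) (sym (+-identityʳ k))) 2k<n) tagged
      (tag≡ , ci≡cj) = combine-injective (tag i) (c i) (tag j) (c j) eq
      (h , h<i , ch≡ci) = repeated-tag i (trans tag≡ (tag-repeated j (i , i<j , ci≡cj)))
  in no-triple h i j h<i i<j ch≡ci ci≡cj
  where
  Repeated : Fin n → Set
  Repeated v = ∃ λ u → u <ᶠ v × c u ≡ c v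

  tag : Fin n → Fin 2
  tag v with any? (λ u → (u <? v) ×-dec (c u ≟ c v))
  ... | yes _ = suc zero
  ... | no  _ = zero

  tag-repeated : ∀ v → Repeated v → tag v ≡ suc zero
  tag-repeated v r with any? (λ u → (u <? v) ×-dec (c u ≟ c v))
  ... | yes _  = refl
  ... | no  ¬r = contradiction r ¬r

  repeated-tag : ∀ v → tag v ≡ suc zero → Repeated v
  repeated-tag v e with any? (λ u → (u <? v) ×-dec (c u ≟ c v))
  repeated-tag v e  | yes r = r
  repeated-tag v () | no  _

  tagged : Fin n → Fin (2 * k)
  tagged v = combine (tag v) (c v)

-- A graph in which every vertex has exactly one non-neighbour besides itself is a complete
-- graph minus a perfect matching; giving both ends of each matching edge the same colour
-- colours it with half as many colours as it has vertices.
module CompleteMinusMatching {m} (H : Graph m) (coDegree≡2 : ∀ v → coDegree H v ≡ 2) where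

  private
    nonAdjacent : Fin m → Fin m → Bool
    nonAdjacent v = not ∘ adj H v

  partner-exists : ∀ v → ∃ λ w → w ≢ v × adj H v w ≡ false
  partner-exists v with any? (λ w → ¬? (w ≟ v) ×-dec (adj H v w ≟ᵇ false))
  ... | yes found = found
  ... | no  none  = contradiction (subst (_≤ 1) (coDegree≡2 v) (count≤1 (nonAdjacent v) v only-v)) 1+n≰n
    where
    only-v : ∀ w → nonAdjacent v w ≡ true → w ≡ v
    only-v w e with w ≟ v
    ... | yes w≡v = w≡v
    ... | no  w≢v = contradiction (w , w≢v , not-injective e) none

  partner : Fin m → Fin m
  partner v = proj₁ (partner-exists v)

  partner≢ : ∀ v → partner v ≢ v
  partner≢ v = proj₁ (proj₂ (partner-exists v))

  partner-non-adjacent : ∀ v → adj H v (partner v) ≡ false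
  partner-non-adjacent v = proj₂ (proj₂ (partner-exists v))

  -- a third non-neighbour of v would give coDegree ≥ 3
  partner-unique : ∀ v w → w ≢ v → adj H v w ≡ false → w ≡ partner v
  partner-unique v w w≢v vw with w ≟ partner v
  ... | yes w≡p = w≡p
  ... | no  w≢p = contradiction (subst (3 ≤_) (coDegree≡2 v) three) 1+n≰n
    where
    three : 3 ≤ coDegree H v
    three = count≥3 (nonAdjacent v) v w (partner v) (w≢v ∘ sym) (partner≢ v ∘ sym) w≢p
                    (cong not (irrefl H v)) (cong not vw) (cong not (partner-non-adjacent v))

  partner-involutive : ∀ v → partner (partner v) ≡ v
  partner-involutive v =
    sym (partner-unique (partner v) v (partner≢ v ∘ sym) (trans (Graph.sym H (partner v) v) (partner-non-adjacent v)))

  leader : Fin m → Bool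
  leader v = toℕ v <ᵇ toℕ (partner v)

  leader-partner : ∀ v → leader (partner v) ≡ not (leader v)
  leader-partner v =
    trans (cong (λ w → toℕ (partner v) <ᵇ toℕ w) (partner-involutive v))
          (<ᵇ-flip (toℕ v) (toℕ (partner v)) (partner≢ v ∘ sym ∘ toℕ-injective))

  leaders : ℕ
  leaders = count leader

  -- the partner involution swaps leaders and non-leaders, so exactly half the vertices lead
  leaders-half : leaders + leaders ≡ m
  leaders-half = begin
    count leader + count leader              ≡⟨ cong (_+ count leader) (count-involution leader partner partner-involutive) ⟩
    count (leader ∘ partner) + count leader  ≡⟨ cong (_+ count leader) (count-ext leader-partner) ⟩
    count (not ∘ leader) + count leader      ≡⟨ count-complement leader ⟩
    m                                        ∎
    where open ≡-Reasoning

  representative : Fin m → Fin m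
  representative v = if leader v then v else partner v

  representative-leads : ∀ v → leader (representative v) ≡ true
  representative-leads v with leader v in e
  ... | true  = e
  ... | false = trans (leader-partner v) (cong not e)

  representative-cases : ∀ v → representative v ≡ v ⊎ representative v ≡ partner v
  representative-cases v with leader v
  ... | true  = inj₁ refl
  ... | false = inj₂ refl

  same-representative : ∀ u v → representative u ≡ representative v → v ≡ u ⊎ v ≡ partner u
  same-representative u v r with representative-cases u | representative-cases v
  ... | inj₁ ru | inj₁ rv = inj₁ (trans (sym rv) (trans (sym r) ru))
  ... | inj₁ ru | inj₂ rv = inj₂ (trans (sym (partner-involutive v)) (cong partner (trans (sym rv) (trans (sym r) ru))))
  ... | inj₂ ru | inj₁ rv = inj₂ (trans (sym rv) (trans (sym r) ru))
  ... | inj₂ ru | inj₂ rv = inj₁ (trans (sym (partner-involutive v))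
                                   (trans (cong partner (trans (sym rv) (trans (sym r) ru))) (partner-involutive u)))

  colour : Fin m → Fin leaders
  colour v = enumerate leader (representative v) (representative-leads v)

  colour-proper : ProperColouring H leaders colour
  colour-proper u v adjacent same = true≢false (trans (sym adjacent) non-adjacent)
    where
    non-adjacent : adj H u v ≡ false
    non-adjacent with same-representative u v
                        (enumerate-injective leader _ _ (representative-leads u) (representative-leads v) same)
    ... | inj₁ v≡u = subst (λ w → adj H u w ≡ false) (sym v≡u) (irrefl H u)
    ... | inj₂ v≡p = subst (λ w → adj H u w ≡ false) (sym v≡p) (partner-non-adjacent u)

follows : ℕ → ℕ → ℕ → Bool
follows n a b = (suc a ≡ᵇ b) ∨ ((suc a ≡ᵇ n) ∧ (b ≡ᵇ 0))

-- adjacency in C_n^c; adj (cycleComplement n) i j unfolds to complAdj n (toℕ i) (toℕ j)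
complAdj : ℕ → ℕ → ℕ → Bool
complAdj n a b = not (a ≡ᵇ b) ∧ not (follows n a b ∨ follows n b a)

follows-suc : ∀ n a → follows n a (suc a) ≡ true
follows-suc n a rewrite ≡ᵇ-refl a = refl

consecutive⇒non-adjacent : ∀ n a b → follows n a b ∨ follows n b a ≡ true → complAdj n a b ≡ false
consecutive⇒non-adjacent n a b e rewrite e = ∧-zeroʳ _

Follows : ℕ → ℕ → ℕ → Set
Follows n a b = suc a ≡ b ⊎ (suc a ≡ n × b ≡ 0)

follows-sound : ∀ n a b → follows n a b ≡ true → Follows n a b
follows-sound n a b e with ∨-true (suc a ≡ᵇ b) _ e
... | inj₁ ab = inj₁ (≡ᵇ-sound _ _ ab)
... | inj₂ e′ with ∧-true (suc a ≡ᵇ n) (b ≡ᵇ 0) e′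
...   | an , b0 = inj₂ (≡ᵇ-sound _ _ an , ≡ᵇ-sound _ _ b0)

non-adjacent-cases : ∀ n a b → complAdj n a b ≡ false → a ≡ b ⊎ Follows n a b ⊎ Follows n b a
non-adjacent-cases n a b e
  with ∨-true (a ≡ᵇ b) _ (not-injective (trans (deMorgan₂ (a ≡ᵇ b) (follows n a b ∨ follows n b a)) e))
... | inj₁ ab = inj₁ (≡ᵇ-sound a b ab)
... | inj₂ e′ with ∨-true (follows n a b) _ e′
...   | inj₁ ab = inj₂ (inj₁ (follows-sound n a b ab))
...   | inj₂ ba = inj₂ (inj₂ (follows-sound n b a ba))

non-adjacent-ordered : ∀ {n a b} → a < b → complAdj n a b ≡ false → b ≡ suc a ⊎ (a ≡ 0 × suc b ≡ n)
non-adjacent-ordered {n} {a} {b} a<b e with non-adjacent-cases n a b e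
... | inj₁ refl                      = contradiction a<b (<-irrefl refl)
... | inj₂ (inj₁ (inj₁ sa≡b))        = inj₁ (sym sa≡b)
... | inj₂ (inj₁ (inj₂ (_ , refl)))  = contradiction a<b λ ()
... | inj₂ (inj₂ (inj₁ refl))        = contradiction a<b (<-asym ≤-refl)
... | inj₂ (inj₂ (inj₂ (sb≡n , a≡0))) = inj₂ (a≡0 , sb≡n)

no-triangle : ∀ {n a b c} → 4 ≤ n → a < b → b < c →
              complAdj n a b ≡ false → complAdj n b c ≡ false → complAdj n a c ≡ false → ⊥
no-triangle {n} {a} {b} {c} 4≤n a<b b<c ab bc ac
  with non-adjacent-ordered {n} (<-trans a<b b<c) ac | non-adjacent-ordered {n} b<c bc | non-adjacent-ordered {n} a<b ab
... | inj₁ refl          | _               | _               = contradiction (s≤s⁻¹ b<c) (<⇒≱ a<b)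
... | inj₂ (refl , _)    | inj₂ (refl , _) | _               = 1+n≰n a<b
... | inj₂ (_ , sc≡n)    | inj₁ refl       | inj₂ (_ , sb≡n) = <⇒≢ ≤-refl (trans sb≡n (sym sc≡n))
... | inj₂ (refl , refl) | inj₁ refl       | inj₁ refl       = 1+n≰n 4≤n

next : ℕ → ℕ → ℕ
next n a = if suc a ≡ᵇ n then 0 else suc a

prev : ℕ → ℕ → ℕ
prev n zero    = pred n
prev n (suc a) = a

follows-next : ∀ n a b → b < n → follows n a b ≡ (b ≡ᵇ next n a)
follows-next n a b b<n with suc a ≡ᵇ n in sa≡n
... | true  rewrite ≢⇒≡ᵇ-false (suc a) b (λ sa≡b → <⇒≢ b<n (trans (sym sa≡b) (≡ᵇ-sound _ _ sa≡n))) = refl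
... | false = trans (∨-identityʳ _) (≡ᵇ-comm (suc a) b)

follows-prev : ∀ n a b → follows (suc n) b a ≡ (b ≡ᵇ prev (suc n) a)
follows-prev n zero    b = ∧-identityʳ _
follows-prev n (suc a) b = trans (cong ((b ≡ᵇ a) ∨_) (∧-zeroʳ _)) (∨-identityʳ _)

next<n : ∀ n a → a < n → next n a < n
next<n n a a<n with suc a ≡ᵇ n in sa≡n
... | true  = ≤-trans (s≤s z≤n) a<n
... | false = ≤∧≢⇒< a<n (≡ᵇ-false⇒≢ (suc a) n sa≡n)

prev<n : ∀ n a → a < n → prev n a < n
prev<n (suc n) zero    _    = ≤-refl
prev<n n       (suc a) sa<n = <-trans ≤-refl sa<n

next≢self : ∀ n a → 2 ≤ n → a ≢ next n a
next≢self n a 2≤n with suc a ≡ᵇ n in sa≡n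
... | true  = λ a≡0 → 1+n≰n (subst (2 ≤_) (trans (sym (≡ᵇ-sound (suc a) n sa≡n)) (cong suc a≡0)) 2≤n)
... | false = <⇒≢ ≤-refl

prev≢self : ∀ n a → 2 ≤ n → a ≢ prev n a
prev≢self _ zero    (s≤s (s≤s _)) ()
prev≢self _ (suc a) _             = <⇒≢ ≤-refl ∘ sym

next≢prev : ∀ n a → 3 ≤ n → next n a ≢ prev n a
next≢prev _ zero    (s≤s (s≤s (s≤s _)))     ()
next≢prev n (suc a) 3≤n@(s≤s (s≤s (s≤s _))) with suc (suc a) ≡ᵇ n in e
... | true  = λ 0≡a → 1+n≰n (subst (3 ≤_) (trans (sym (≡ᵇ-sound _ _ e)) (cong (2 +_) (sym 0≡a))) 3≤n)
... | false = <⇒≢ (≤-trans ≤-refl (n≤1+n _)) ∘ sym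

closedNbr : ∀ {n} → ℕ → Fin n → Bool
closedNbr {n} a w = at a w ∨ (at (next n a) w ∨ at (prev n a) w)

complAdj≡not-closedNbr : ∀ n a (w : Fin (suc n)) →
                         complAdj (suc n) a (toℕ w) ≡ not (closedNbr a w)
complAdj≡not-closedNbr n a w = begin
  not (a ≡ᵇ b) ∧ not (follows (suc n) a b ∨ follows (suc n) b a)  ≡⟨ deMorgan₂ (a ≡ᵇ b) _ ⟨
  not ((a ≡ᵇ b) ∨ (follows (suc n) a b ∨ follows (suc n) b a))    ≡⟨ cong not (cong₂ _∨_ (≡ᵇ-comm a b)
                                                                       (cong₂ _∨_ (follows-next (suc n) a b (toℕ<n w)) (follows-prev n a b))) ⟩
  not (closedNbr a w)                                             ∎
  where
  open ≡-Reasoning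
  b : ℕ
  b = toℕ w

-- Each vertex of C_n^c misses exactly itself and its two cycle neighbours.
cycleComplement-regular : ∀ n → 3 ≤ n → Regular (n ∸ 3) (cycleComplement n)
cycleComplement-regular n 3≤n@(s≤s (s≤s (s≤s _))) v = begin
  degree (cycleComplement n) v                       ≡⟨ degree≡count (cycleComplement n) v ⟩
  count (adj (cycleComplement n) v)                  ≡⟨ count-ext (complAdj≡not-closedNbr _ a) ⟩
  count (not ∘ closed)                               ≡⟨ m+n∸n≡m _ 3 ⟨
  count (not ∘ closed) + 3 ∸ 3                       ≡⟨ cong (λ k → count (not ∘ closed) + k ∸ 3) three ⟨
  count (not ∘ closed) + count closed ∸ 3            ≡⟨ cong (_∸ 3) (count-complement closed) ⟩
  n ∸ 3                                              ∎
  where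
  open ≡-Reasoning
  a : ℕ
  a = toℕ v
  closed : Fin n → Bool
  closed = closedNbr a
  2≤n : 2 ≤ n
  2≤n = ≤-trans (s≤s (s≤s z≤n)) 3≤n
  three : count closed ≡ 3
  three = count-at₃ (toℕ<n v) (next<n n a (toℕ<n v)) (prev<n n a (toℕ<n v))
                    (next≢self n a 2≤n) (prev≢self n a 2≤n) (next≢prev n a 3≤n)

same-half : ∀ a b → ⌊ a /2⌋ ≡ ⌊ b /2⌋ → a ≡ b ⊎ suc a ≡ b ⊎ suc b ≡ a
same-half 0             0             _ = inj₁ refl
same-half 0             1             _ = inj₂ (inj₁ refl)
same-half 1             0             _ = inj₂ (inj₂ refl)
same-half 1             1             _ = inj₁ refl
same-half 0             (suc (suc b)) ()
same-half 1             (suc (suc b)) ()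
same-half (suc (suc a)) 0             ()
same-half (suc (suc a)) 1             ()
same-half (suc (suc a)) (suc (suc b)) e =
  Sum.map (cong (2 +_)) (Sum.map (cong (2 +_)) (cong (2 +_))) (same-half a b (suc-injective e))

equal-or-consecutive⇒non-adjacent : ∀ n a b → a ≡ b ⊎ suc a ≡ b ⊎ suc b ≡ a → complAdj n a b ≡ false
equal-or-consecutive⇒non-adjacent n a .a (inj₁ refl) rewrite ≡ᵇ-refl a = refl
equal-or-consecutive⇒non-adjacent n a _  (inj₂ (inj₁ refl)) =
  consecutive⇒non-adjacent n a (suc a) (cong (_∨ follows n (suc a) a) (follows-suc n a))
equal-or-consecutive⇒non-adjacent n _ b  (inj₂ (inj₂ refl)) =
  consecutive⇒non-adjacent n (suc b) b (trans (cong (follows n (suc b) b ∨_) (follows-suc n b)) (∨-zeroʳ _))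

half-colour : ∀ n → Fin n → Fin ⌈ n /2⌉
half-colour n i = fromℕ< (⌈n/2⌉-mono (toℕ<n i))

half-colour-proper : ∀ n → ProperColouring (cycleComplement n) ⌈ n /2⌉ (half-colour n)
half-colour-proper n u v adjacent same =
  true≢false (trans (sym adjacent) (equal-or-consecutive⇒non-adjacent n (toℕ u) (toℕ v) (same-half _ _ halves)))
  where
  halves : ⌊ toℕ u /2⌋ ≡ ⌊ toℕ v /2⌋
  halves = trans (sym (toℕ-fromℕ< _)) (trans (cong toℕ same) (toℕ-fromℕ< _))

⌈/2⌉≤ : ∀ {n k} → n ≤ k + k → ⌈ n /2⌉ ≤ k
⌈/2⌉≤ {n} {k} n≤2k = subst (⌈ n /2⌉ ≤_) (sym (n≡⌈n+n/2⌉ k)) (⌈n/2⌉-mono n≤2k)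

-- Colour classes of C_n^c are cliques of C_n, hence have at most two vertices (n ≥ 4).
cycleComplement-colours≥ : ∀ n k → 4 ≤ n → Colourable (cycleComplement n) k → ⌈ n /2⌉ ≤ k
cycleComplement-colours≥ n k 4≤n (c , proper) = ⌈/2⌉≤ (at-most-two-per-colour c no-triple)
  where
  non-adjacent : ∀ u v → c u ≡ c v → complAdj n (toℕ u) (toℕ v) ≡ false
  non-adjacent = same-colour⇒non-adjacent (cycleComplement n) proper
  no-triple : ∀ h i j → h <ᶠ i → i <ᶠ j → c h ≡ c i → c i ≡ c j → ⊥
  no-triple h i j h<i i<j ch≡ci ci≡cj =
    no-triangle 4≤n h<i i<j (non-adjacent h i ch≡ci) (non-adjacent i j ci≡cj) (non-adjacent h j (trans ch≡ci ci≡cj))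

n≤2⌈n/2⌉ : ∀ n → n ≤ ⌈ n /2⌉ + ⌈ n /2⌉
n≤2⌈n/2⌉ n = ≤-trans (≤-reflexive (sym (⌊n/2⌋+⌈n/2⌉≡n n))) (+-monoˡ-≤ ⌈ n /2⌉ (⌊n/2⌋≤⌈n/2⌉ n))

-- All its vertices have the same number d of non-neighbours (itself included), and the
-- order is d + n − 3; the cases d = 1 and d = 2 contradict the chromatic number.
order-bound : ∀ {n m} (H : Graph m) → 6 ≤ n → IsRχGraph (n ∸ 3) ⌈ n /2⌉ H → n ≤ m
order-bound {m = zero} H (s≤s (s≤s (s≤s (s≤s (s≤s (s≤s _)))))) (_ , _ , χ-minimal)
  with () ← χ-minimal 0 (identity-colouring H)
order-bound {n} {suc m} H (s≤s (s≤s (s≤s (s≤s (s≤s (s≤s {n = u} _)))))) (regular , χ-colourable , χ-minimal) =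
  by-coDegree (coDegree H zero) refl
  where
  order : ∀ v → coDegree H v + (3 + u) ≡ suc m
  order v = trans (cong (coDegree H v +_) (sym (regular v))) (coDegree+degree H v)

  constant : ∀ {d} → coDegree H zero ≡ d → ∀ v → coDegree H v ≡ d
  constant e v = trans (+-cancelʳ-≡ _ _ _ (trans (order v) (sym (order zero)))) e

  by-coDegree : ∀ d → coDegree H zero ≡ d → n ≤ suc m
  by-coDegree 0 e = contradiction (subst (1 ≤_) e (coDegree≥1 H zero)) λ ()
  by-coDegree 1 e = contradiction (≤-trans (s≤s⁻¹ (s≤s⁻¹ (s≤s⁻¹ n-2≤χ))) (⌈n/2⌉≤n u)) 1+n≰n
    where
    -- H is complete of order n − 2
    n-2≤χ : 4 + u ≤ ⌈ n /2⌉
    n-2≤χ = subst (_≤ ⌈ n /2⌉) (trans (sym (order zero)) (cong (_+ (3 + u)) e))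
                  (complete⇒colours≥order H (coDegree≡1⇒complete H (constant e)) χ-colourable)
  by-coDegree 2 e = contradiction n≤n-1 1+n≰n
    where
    -- H is complete of order n − 1 minus a perfect matching
    open CompleteMinusMatching H (constant e)
    n≤n-1 : n ≤ 5 + u
    n≤n-1 = begin
      n                            ≤⟨ n≤2⌈n/2⌉ n ⟩
      ⌈ n /2⌉ + ⌈ n /2⌉            ≤⟨ +-mono-≤ χ≤leaders χ≤leaders ⟩
      leaders + leaders            ≡⟨ leaders-half ⟩
      suc m                        ≡⟨ order zero ⟨
      coDegree H zero + (3 + u)    ≡⟨ cong (_+ (3 + u)) e ⟩
      5 + u                        ∎
      where
      open ≤-Reasoning
      χ≤leaders : ⌈ n /2⌉ ≤ leaders
      χ≤leaders = χ-minimal leaders (colour , colour-proper)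
  by-coDegree (suc (suc (suc d))) e =
    subst (n ≤_) (trans (cong (_+ (3 + u)) (sym e)) (order zero)) (+-monoˡ-≤ (3 + u) (s≤s (s≤s (s≤s z≤n))))

theorem3 : (n : ℕ) → 6 ≤ n →
    Extremal (n ∸ 3) ⌈ n /2⌉ (cycleComplement n)
theorem3 n 6≤n =
  ( cycleComplement-regular n (≤-trans (m≤m+n 3 3) 6≤n)
  , (half-colour n , half-colour-proper n)
  , (λ k → cycleComplement-colours≥ n k (≤-trans (m≤m+n 4 2) 6≤n)) )
  , λ m H → order-bound H 6≤n
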